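{- If the consecution $X\Rightarrow A$ is provable in $\mathbf{B}$, then $X$ and $A$ $\mathsf{rseq}$-share a variable: there exist an atom $p$ and a reduced sequence $\overline{x}\in\mathsf{rseq}$ such that $p$ has an occurrence falling under $\overline{x}$ in $X$ and an occurrence falling under $\overline{x}$ in $A$.
   Context: Language: atoms $\mathsf{At}$; formulas built by $\neg,\land,\lor,\to,\circ$; bunches built from formulas by comma $(X,Y)$ and semicolon $(X;Y)$; a consecution is $X\Rightarrow A$. $Y(X)$ denotes $Y$ with a distinguished occurrence of subbunch $X$, $Y(Z)$ the replacement by $Z$. Parsing tree: the expression is the root; $X;Y$, $X,Y$, $A\land B$, $A\lor B$, $A\to B$, $A\circ B$ have two children in order, $\neg A$ has child $A$, atoms are leaves; an occurrence is a node. Sequences: $\mathsf{seq}$ = finite sequences over $\{l,r,\lambda,\rho,n\}$, juxtaposition = concatenation, $\varepsilon$ empty. One-step reduction: $\overline{a}l\lambda\overline{b}\rightsquigarrow'\overline{a}\rho\overline{b}$; $\overline{a}r\lambda\overline{b}\rightsquigarrow'\overline{a}\overline{b}$; $\overline{a}\lambda r\overline{b}\rightsquigarrow'\overline{a}\overline{b}$; $\overline{a}\rho r\overline{b}\rightsquigarrow'\overline{a}l\overline{b}$; $\overline{a}nn\overline{b}\rightsquigarrow'\overline{a}\overline{b}$. $\mathsf{rseq}$ = reduced sequences; $\mathsf{red}(\overline{a})$ = the unique reduced sequence reachable from $\overline{a}$ by finitely many steps. $\mathsf{rseq}$-annotation of a parsing tree: the root gets $\varepsilon$; if a node gets $\overline{a}$,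 then for $X;Y$ and $A\circ B$ the left child gets $\mathsf{red}(\lambda\overline{a})$ and the right child $\mathsf{red}(\rho\overline{a})$; for $A\to B$, $A$ gets $\mathsf{red}(l\overline{a})$ and $B$ gets $\mathsf{red}(r\overline{a})$; for $\neg A$, $A$ gets $\mathsf{red}(n\overline{a})$; children of $X,Y$, $A\land B$, $A\lor B$ get $\overline{a}$. An occurrence falls under its annotation. Rules of $\mathbf{B}$ (premises / conclusion): (id): $A\Rightarrow A$. ($\to$I): $X;A\Rightarrow B$ / $X\Rightarrow A\to B$. ($\to$E): $X\Rightarrow A\to B$, $Y\Rightarrow A$ / $X;Y\Rightarrow B$. ($\lor$I$_1$): $X\Rightarrow A$ / $X\Rightarrow A\lor B$. ($\lor$I$_2$): $X\Rightarrow B$ / $X\Rightarrow A\lor B$. ($\lor$E): $X\Rightarrow A\lor B$, $Y(A)\Rightarrow C$, $Y(B)\Rightarrow C$ / $Y(X)\Rightarrow C$. ($\land$I): $X\Rightarrow A$, $Y\Rightarrow B$ / $X,Y\Rightarrow A\land B$. ($\land$E): $X\Rightarrow A\land B$, $Y(A,B)\Rightarrow C$ / $Y(X)\Rightarrow C$. ($\circ$I): $X\Rightarrow A$, $Y\Rightarrow B$ / $X;Y\Rightarrow A\circ B$. ($\circ$E): $X\Rightarrow A\circ B$, $Y(A;B)\Rightarrow C$ / $Y(X)\Rightarrow C$. ($\neg$I): $X\Rightarrow B$, $A\Rightarrow\neg B$ / $X\Rightarrow\neg A$. ($\neg$E): $X\Rightarrow\neg\neg A$ / $X\Rightarrow A$.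 (Cut): $X\Rightarrow A$, $Y(A)\Rightarrow B$ / $Y(X)\Rightarrow B$. Structural: $W(X,(Y,Z))\Rightarrow A$ / $W((X,Y),Z)\Rightarrow A$; $W(X,Y)\Rightarrow A$ / $W(Y,X)\Rightarrow A$; $W(X,X)\Rightarrow A$ / $W(X)\Rightarrow A$; $W(X)\Rightarrow A$ / $W(X,Y)\Rightarrow A$. A consecution is provable in $\mathbf{B}$ if it is the root of a finite derivation tree built from these rules whose leaves are all (id) instances. -}

module Defs where

open import Data.List using (List; []; _∷_; _++_)
open import Data.Product using (Σ; ∃; _×_; _,_)
open import Relation.Nullary using (¬_)
open import Relation.Binary.Construct.Closure.ReflexiveTransitive using (Star)

module _ (At : Set) where

  data Fm : Set where
    atom : At → Fm
    ¬'_  : Fm → Fm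
    _∧'_ : Fm → Fm → Fm
    _∨'_ : Fm → Fm → Fm
    _⇒'_ : Fm → Fm → Fm
    _∘'_ : Fm → Fm → Fm

  data Bunch : Set where
    fm  : Fm → Bunch
    _,,_ : Bunch → Bunch → Bunch
    _︔_ : Bunch → Bunch → Bunch

  data Ctx : Set where
    hole : Ctx
    _,,ˡ_ : Ctx → Bunch → Ctx
    _,,ʳ_ : Bunch → Ctx → Ctx
    _︔ˡ_ : Ctx → Bunch → Ctx
    _︔ʳ_ : Bunch → Ctx → Ctx

module _ {At : Set} where

  plug : Ctx At → Bunch At → Bunch At
  plug hole         Z = Z
  plug (C ,,ˡ Y) Z = plug C Z ,, Y
  plug (Y ,,ʳ C) Z = Y ,, plug C Z
  plug (C ︔ˡ Y) Z = plug C Z ︔ Y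
  plug (Y ︔ʳ C) Z = Y ︔ plug C Z

  data ⊢B : Bunch At → Fm At → Set where
    id    : ∀ {A} → ⊢B (fm A) A
    →I    : ∀ {X A B} → ⊢B (X ︔ fm A) B → ⊢B X (A ⇒' B)
    →E    : ∀ {X Y A B} → ⊢B X (A ⇒' B) → ⊢B Y A → ⊢B (X ︔ Y) B
    ∨I₁   : ∀ {X A B} → ⊢B X A → ⊢B X (A ∨' B)
    ∨I₂   : ∀ {X A B} → ⊢B X B → ⊢B X (A ∨' B)
    ∨E    : ∀ {X A B C} (Y : Ctx At) → ⊢B X (A ∨' B) → ⊢B (plug Y (fm A)) C
            → ⊢B (plug Y (fm B)) C → ⊢B (plug Y X) C
    ∧I    : ∀ {X Y A B} → ⊢B X A → ⊢B Y B → ⊢B (X ,, Y) (A ∧' B)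
    ∧E    : ∀ {X A B C} (Y : Ctx At) → ⊢B X (A ∧' B)
            → ⊢B (plug Y (fm A ,, fm B)) C → ⊢B (plug Y X) C
    ∘I    : ∀ {X Y A B} → ⊢B X A → ⊢B Y B → ⊢B (X ︔ Y) (A ∘' B)
    ∘E    : ∀ {X A B C} (Y : Ctx At) → ⊢B X (A ∘' B)
            → ⊢B (plug Y (fm A ︔ fm B)) C → ⊢B (plug Y X) C
    ¬I    : ∀ {X A B} → ⊢B X B → ⊢B (fm A) (¬' B) → ⊢B X (¬' A)
    ¬E    : ∀ {X A} → ⊢B X (¬' (¬' A)) → ⊢B X A
    cut   : ∀ {X A B} (Y : Ctx At) → ⊢B X A → ⊢B (plug Y (fm A)) B → ⊢B (plug Y X) B
    assoc : ∀ {X Y Z A} (W : Ctx At) → ⊢B (plug W (X ,, (Y ,, Z))) A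
            → ⊢B (plug W ((X ,, Y) ,, Z)) A
    comm  : ∀ {X Y A} (W : Ctx At) → ⊢B (plug W (X ,, Y)) A → ⊢B (plug W (Y ,, X)) A
    contr : ∀ {X A} (W : Ctx At) → ⊢B (plug W (X ,, X)) A → ⊢B (plug W X) A
    weak  : ∀ {X Y A} (W : Ctx At) → ⊢B (plug W X) A → ⊢B (plug W (X ,, Y)) A

data Sym : Set where
  l r lam rho n : Sym

Seq : Set
Seq = List Sym

data _⇝'_ : Seq → Seq → Set where
  lλ : ∀ a b → (a ++ l ∷ lam ∷ b) ⇝' (a ++ rho ∷ b)
  rλ : ∀ a b → (a ++ r ∷ lam ∷ b) ⇝' (a ++ b)
  λr : ∀ a b → (a ++ lam ∷ r ∷ b) ⇝' (a ++ b)
  ρr : ∀ a b → (a ++ rho ∷ r ∷ b) ⇝' (a ++ l ∷ b)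
  nn : ∀ a b → (a ++ n ∷ n ∷ b) ⇝' (a ++ b)

_⇝*_ : Seq → Seq → Set
_⇝*_ = Star _⇝'_

Reduced : Seq → Set
Reduced a = ∀ b → ¬ (a ⇝' b)

-- "b = red(a)": b is reduced and reachable from a
-- (unique by confluence and termination of ⇝')
IsRed : Seq → Seq → Set
IsRed a b = (a ⇝* b) × Reduced b

-- rseq-annotation of parsing trees.
-- OccF a A p x : in the formula A whose root is annotated a, some
-- occurrence of the atom p is annotated (falls under) x.

module _ {At : Set} where

  data OccF : Seq → Fm At → At → Seq → Set where
    here  : ∀ {a p} → OccF a (atom p) p a
    neg   : ∀ {a b A p x} → IsRed (n ∷ a) b → OccF b A p x → OccF a (¬' A) p x
    andL  : ∀ {a A B p x} → OccF a A p x → OccF a (A ∧' B) p x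
    andR  : ∀ {a A B p x} → OccF a B p x → OccF a (A ∧' B) p x
    orL   : ∀ {a A B p x} → OccF a A p x → OccF a (A ∨' B) p x
    orR   : ∀ {a A B p x} → OccF a B p x → OccF a (A ∨' B) p x
    impL  : ∀ {a b A B p x} → IsRed (l ∷ a) b → OccF b A p x → OccF a (A ⇒' B) p x
    impR  : ∀ {a b A B p x} → IsRed (r ∷ a) b → OccF b B p x → OccF a (A ⇒' B) p x
    fusL  : ∀ {a b A B p x} → IsRed (lam ∷ a) b → OccF b A p x → OccF a (A ∘' B) p x
    fusR  : ∀ {a b A B p x} → IsRed (rho ∷ a) b → OccF b B p x → OccF a (A ∘' B) p x

  data OccB : Seq → Bunch At → At → Seq → Set where
    leaf  : ∀ {a A p x} → OccF a A p x → OccB a (fm A) p x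
    comL  : ∀ {a X Y p x} → OccB a X p x → OccB a (X ,, Y) p x
    comR  : ∀ {a X Y p x} → OccB a Y p x → OccB a (X ,, Y) p x
    semL  : ∀ {a b X Y p x} → IsRed (lam ∷ a) b → OccB b X p x → OccB a (X ︔ Y) p x
    semR  : ∀ {a b X Y p x} → IsRed (rho ∷ a) b → OccB b Y p x → OccB a (X ︔ Y) p x

{-# OPTIONS --safe #-}
-- Fix X and read every atom p as both true and false at a reduced sequence x exactly when p
-- occurs under x in X.  Truth and falsity are propagated only along the spine of a formula:
-- ¬A at a is A at red(na) with truth and falsity exchanged, A → B at a is B at red(ra), and
-- A ∘ B and X ; Y at a are their left components at red(λa).  Because red(λ red(ra)),
-- red(r red(λa)) and red(n red(na)) all equal a for reduced a, every rule of B preserves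
-- "X true at a gives A true at a, A false at a gives X false at a".  Every bunch is both true
-- and false at its own annotation, so A is true at ε; and whatever is true or false at some
-- position contains an atom occurrence under an x at which that atom is true, i.e. an atom
-- occurring under x in X.
module Submission where

open import Defs
open import Data.List using ([]; _∷_; _++_)
open import Data.List.Relation.Unary.Linked as Linked using (Linked; []; [-]; _∷_)
open import Data.Nat using (ℕ)
open import Data.Nat.Properties using (eq?)
open import Data.Product as Prod using (Σ; _×_; _,_; proj₁; proj₂; swap; assocʳ′)
open import Data.Sum as Sum using (_⊎_; inj₁; inj₂; [_,_]′)
open import Function using (_∘_)
open import Function.Bundles using (mk↣)
open import Relation.Binary.Definitions using (DecidableEquality)
open import Relation.Binary.PropositionalEquality using (_≡_; _≢_; refl; sym; trans; cong; subst)
open import Relation.Binary.Construct.Closure.ReflexiveTransitive using (ε; _◅_)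
open import Relation.Nullary using (yes; no; contradiction)

code : Sym → ℕ
code l   = 0
code r   = 1
code lam = 2
code rho = 3
code n   = 4

decode : ℕ → Sym
decode 0 = l
decode 1 = r
decode 2 = lam
decode 3 = rho
decode _ = n

decode-code : ∀ s → decode (code s) ≡ s
decode-code l   = refl
decode-code r   = refl
decode-code lam = refl
decode-code rho = refl
decode-code n   = refl

_≟_ : DecidableEquality Sym
_≟_ = eq? (mk↣ λ {s} {t} eq → trans (sym (decode-code s)) (trans (cong decode eq) (decode-code t)))

-- The five rules of ⇝' contract exactly the pairs s (partner s), one for each symbol s.
partner : Sym → Sym
partner l   = lam
partner r   = lam
partner lam = r
partner rho = r
partner n   = n

contract : Sym → Seq → Seq
contract l   a = rho ∷ a
contract r   a = a
contract lam a = a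
contract rho a = l ∷ a
contract n   a = a

contract-step : ∀ s a → (s ∷ partner s ∷ a) ⇝' contract s a
contract-step l   = lλ []
contract-step r   = rλ []
contract-step lam = λr []
contract-step rho = ρr []
contract-step n   = nn []

Normal : Seq → Set
Normal = Linked (λ s t → partner s ≢ t)

linked-adjacent : ∀ {R : Sym → Sym → Set} a {s t b} → Linked R (a ++ s ∷ t ∷ b) → R s t
linked-adjacent []      la = Linked.head la
linked-adjacent (_ ∷ a) la = linked-adjacent a (Linked.tail la)

Normal⇒Reduced : ∀ {a} → Normal a → Reduced a
Normal⇒Reduced na _ (lλ a _) = linked-adjacent a na refl
Normal⇒Reduced na _ (rλ a _) = linked-adjacent a na refl
Normal⇒Reduced na _ (λr a _) = linked-adjacent a na refl
Normal⇒Reduced na _ (ρr a _) = linked-adjacent a na refl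
Normal⇒Reduced na _ (nn a _) = linked-adjacent a na refl

Normal-replaceHead : ∀ {s t a} → partner s ≡ partner t → Normal (s ∷ a) → Normal (t ∷ a)
Normal-replaceHead _  [-]       = [-]
Normal-replaceHead eq (ns ∷ na) = ns ∘ trans eq ∷ na

contract-normal : ∀ s {a} → Normal (partner s ∷ a) → Normal (contract s a)
contract-normal l   = Normal-replaceHead refl
contract-normal r   = Linked.tail
contract-normal lam = Linked.tail
contract-normal rho = Normal-replaceHead refl
contract-normal n   = Linked.tail

infixr 5 _◃_

_◃_ : Sym → Seq → Seq
s ◃ []      = s ∷ []
s ◃ (t ∷ a) with partner s ≟ t
... | yes _ = contract s a
... | no _  = s ∷ t ∷ a

◃-reduces : ∀ s a → (s ∷ a) ⇝* (s ◃ a)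
◃-reduces s []      = ε
◃-reduces s (t ∷ a) with partner s ≟ t
... | yes refl = contract-step s a ◅ ε
... | no _     = ε

◃-normal : ∀ s {a} → Normal a → Normal (s ◃ a)
◃-normal s {[]}    _  = [-]
◃-normal s {t ∷ a} na with partner s ≟ t
... | yes refl = contract-normal s na
... | no ¬p    = ¬p ∷ na

◃-isRed : ∀ s {a} → Normal a → IsRed (s ∷ a) (s ◃ a)
◃-isRed s {a} na = ◃-reduces s a , Normal⇒Reduced (◃-normal s na)

◃-stable : ∀ {s a} → Normal (s ∷ a) → s ◃ a ≡ s ∷ a
◃-stable {a = []} _ = refl
◃-stable {s} {t ∷ a} (¬p ∷ _) with partner s ≟ t
... | yes p = contradiction p ¬p
... | no _  = refl

lam◃r◃a≡a : ∀ {a} → Normal a → lam ◃ r ◃ a ≡ a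
lam◃r◃a≡a {[]}    _  = refl
lam◃r◃a≡a {t ∷ a} na with partner r ≟ t
... | yes refl = ◃-stable na
... | no _     = refl

r◃lam◃a≡a : ∀ {a} → Normal a → r ◃ lam ◃ a ≡ a
r◃lam◃a≡a {[]}    _  = refl
r◃lam◃a≡a {t ∷ a} na with partner lam ≟ t
... | yes refl = ◃-stable na
... | no _     = refl

n◃n◃a≡a : ∀ {a} → Normal a → n ◃ n ◃ a ≡ a
n◃n◃a≡a {[]}    _  = refl
n◃n◃a≡a {t ∷ a} na with partner n ≟ t
... | yes refl = ◃-stable na
... | no _     = refl

module Semantics {At : Set} (V : At → Seq → Set) where

  Holds Fails : Fm At → Seq → Set
  Holds (atom p) a = V p a
  Holds (¬' A)   a = Fails A (n ◃ a)
  Holds (A ∧' B) a = Holds A a × Holds B a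
  Holds (A ∨' B) a = Holds A a ⊎ Holds B a
  Holds (A ⇒' B) a = Holds B (r ◃ a)
  Holds (A ∘' B) a = Holds A (lam ◃ a)
  Fails (atom p) a = V p a
  Fails (¬' A)   a = Holds A (n ◃ a)
  Fails (A ∧' B) a = Fails A a ⊎ Fails B a
  Fails (A ∨' B) a = Fails A a × Fails B a
  Fails (A ⇒' B) a = Fails B (r ◃ a)
  Fails (A ∘' B) a = Fails A (lam ◃ a)

  Holdsᴮ Failsᴮ : Bunch At → Seq → Set
  Holdsᴮ (fm A)   a = Holds A a
  Holdsᴮ (X ,, Y) a = Holdsᴮ X a × Holdsᴮ Y a
  Holdsᴮ (X ︔ Y)  a = Holdsᴮ X (lam ◃ a)
  Failsᴮ (fm A)   a = Fails A a
  Failsᴮ (X ,, Y) a = Failsᴮ X a ⊎ Failsᴮ Y a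
  Failsᴮ (X ︔ Y)  a = Failsᴮ X (lam ◃ a)

  _at_≼_at_ : Bunch At → Seq → Bunch At → Seq → Set
  X at a ≼ Y at b = (Holdsᴮ X a → Holdsᴮ Y b) × (Failsᴮ Y b → Failsᴮ X a)

  record _⊑_ (X Y : Bunch At) : Set where
    constructor mk⊑
    field
      pointwise : ∀ {a} → Normal a → X at a ≼ Y at a

  open _⊑_ public

  ⊑-trans : ∀ {X Y Z} → X ⊑ Y → Y ⊑ Z → X ⊑ Z
  ⊑-trans X⊑Y Y⊑Z = mk⊑ λ na →
    let f , g = pointwise X⊑Y na; f′ , g′ = pointwise Y⊑Z na in f′ ∘ f , g ∘ g′

  fm-∧⊑,, : ∀ {A B} → fm (A ∧' B) ⊑ (fm A ,, fm B)
  fm-∧⊑,, = mk⊑ λ _ → (λ x → x) , (λ x → x)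

  fm-∘⊑︔ : ∀ {A B} → fm (A ∘' B) ⊑ (fm A ︔ fm B)
  fm-∘⊑︔ = mk⊑ λ _ → (λ x → x) , (λ x → x)

  plug-mono : ∀ Y {Z Z′} → Z ⊑ Z′ → plug Y Z ⊑ plug Y Z′
  plug-mono Y {Z} {Z′} Z⊑Z′ = mk⊑ (go Y)
    where
    go : ∀ Y {a} → Normal a → plug Y Z at a ≼ plug Y Z′ at a
    go hole      na = pointwise Z⊑Z′ na
    go (C ,,ˡ _) na = let f , g = go C na in Prod.map₁ f , Sum.map₁ g
    go (_ ,,ʳ C) na = let f , g = go C na in Prod.map₂ f , Sum.map₂ g
    go (C ︔ˡ _)  na = go C (◃-normal lam na)
    go (_ ︔ʳ _)  na = (λ x → x) , (λ x → x)

  plug-holds-∨ : ∀ Y {A B a} → Holdsᴮ (plug Y (fm (A ∨' B))) a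
               → Holdsᴮ (plug Y (fm A)) a ⊎ Holdsᴮ (plug Y (fm B)) a
  plug-holds-∨ hole      h       = h
  plug-holds-∨ (C ,,ˡ _) (h , w) = Sum.map (_, w) (_, w) (plug-holds-∨ C h)
  plug-holds-∨ (_ ,,ʳ C) (w , h) = Sum.map (w ,_) (w ,_) (plug-holds-∨ C h)
  plug-holds-∨ (C ︔ˡ _)  h       = plug-holds-∨ C h
  plug-holds-∨ (_ ︔ʳ _)  h       = inj₁ h

  plug-fails-∨ : ∀ Y {A B a} → Failsᴮ (plug Y (fm A)) a → Failsᴮ (plug Y (fm B)) a
               → Failsᴮ (plug Y (fm (A ∨' B))) a
  plug-fails-∨ hole      f         g         = f , g
  plug-fails-∨ (C ,,ˡ _) (inj₁ f)  (inj₁ g)  = inj₁ (plug-fails-∨ C f g)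
  plug-fails-∨ (C ,,ˡ _) (inj₁ _)  (inj₂ w)  = inj₂ w
  plug-fails-∨ (C ,,ˡ _) (inj₂ w)  _         = inj₂ w
  plug-fails-∨ (_ ,,ʳ C) (inj₂ f)  (inj₂ g)  = inj₂ (plug-fails-∨ C f g)
  plug-fails-∨ (_ ,,ʳ C) (inj₂ _)  (inj₁ w)  = inj₁ w
  plug-fails-∨ (_ ,,ʳ C) (inj₁ w)  _         = inj₁ w
  plug-fails-∨ (C ︔ˡ _)  f         g         = plug-fails-∨ C f g
  plug-fails-∨ (_ ︔ʳ _)  f         _         = f

  plug-∨ : ∀ Y {A B C} → plug Y (fm A) ⊑ fm C → plug Y (fm B) ⊑ fm C
         → plug Y (fm (A ∨' B)) ⊑ fm C
  plug-∨ Y A⊑C B⊑C = mk⊑ λ na →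
    let f₁ , g₁ = pointwise A⊑C na; f₂ , g₂ = pointwise B⊑C na
    in [ f₁ , f₂ ]′ ∘ plug-holds-∨ Y , λ c → plug-fails-∨ Y (g₁ c) (g₂ c)

  sound : ∀ {X A} → ⊢B X A → X ⊑ fm A
  sound id = mk⊑ λ _ → (λ x → x) , (λ x → x)
  sound (→I {X} {A} {B} d) = mk⊑ λ {a} na →
    subst (λ c → X at c ≼ fm B at (r ◃ a)) (lam◃r◃a≡a na) (pointwise (sound d) (◃-normal r na))
  sound (→E {X} {B = B} d _) = mk⊑ λ {a} na →
    subst (λ c → X at (lam ◃ a) ≼ fm B at c) (r◃lam◃a≡a na) (pointwise (sound d) (◃-normal lam na))
  sound (∨I₁ d) = mk⊑ λ na → let f , g = pointwise (sound d) na in inj₁ ∘ f , g ∘ proj₁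
  sound (∨I₂ d) = mk⊑ λ na → let f , g = pointwise (sound d) na in inj₂ ∘ f , g ∘ proj₂
  sound (∨E Y d e₁ e₂) = ⊑-trans (plug-mono Y (sound d)) (plug-∨ Y (sound e₁) (sound e₂))
  sound (∧I d e) = mk⊑ λ na →
    let f , g = pointwise (sound d) na; f′ , g′ = pointwise (sound e) na
    in Prod.map f f′ , Sum.map g g′
  sound (∧E Y d e) = ⊑-trans (plug-mono Y (⊑-trans (sound d) fm-∧⊑,,)) (sound e)
  sound (∘I d _) = mk⊑ λ na → pointwise (sound d) (◃-normal lam na)
  sound (∘E Y d e) = ⊑-trans (plug-mono Y (⊑-trans (sound d) fm-∘⊑︔)) (sound e)
  sound (¬I {B = B} d e) = mk⊑ λ {a} na →
    let f , g = pointwise (sound d) na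
        f′ , g′ = pointwise (sound e) (◃-normal n na)
    in g′ ∘ subst (Holds B) (sym (n◃n◃a≡a na)) ∘ f , g ∘ subst (Fails B) (n◃n◃a≡a na) ∘ f′
  sound (¬E {X} {A} d) = mk⊑ λ {a} na →
    subst (λ c → X at a ≼ fm A at c) (n◃n◃a≡a na) (pointwise (sound d) na)
  sound (cut Y d e) = ⊑-trans (plug-mono Y (sound d)) (sound e)
  sound (assoc W d) = ⊑-trans (plug-mono W (mk⊑ λ _ → assocʳ′ , Sum.assocˡ)) (sound d)
  sound (comm W d)  = ⊑-trans (plug-mono W (mk⊑ λ _ → swap , Sum.swap)) (sound d)
  sound (contr W d) = ⊑-trans (plug-mono W (mk⊑ λ _ → (λ x → x , x) , Sum.reduce)) (sound d)
  sound (weak W d)  = ⊑-trans (plug-mono W (mk⊑ λ _ → proj₁ , inj₁)) (sound d)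

  holds×fails : ∀ A {a} → Normal a → (∀ {p x} → OccF a A p x → V p x)
              → Holds A a × Fails A a
  holds×fails (atom p) na occ⊆V = occ⊆V here , occ⊆V here
  holds×fails (¬' A)   na occ⊆V = swap (holds×fails A (◃-normal n na) (occ⊆V ∘ neg (◃-isRed n na)))
  holds×fails (A ∧' B) na occ⊆V =
    Prod.zip _,_ (λ f _ → inj₁ f) (holds×fails A na (occ⊆V ∘ andL))
                                  (holds×fails B na (occ⊆V ∘ andR))
  holds×fails (A ∨' B) na occ⊆V =
    Prod.zip (λ h _ → inj₁ h) _,_ (holds×fails A na (occ⊆V ∘ orL))
                                  (holds×fails B na (occ⊆V ∘ orR))
  holds×fails (A ⇒' B) na occ⊆V = holds×fails B (◃-normal r na) (occ⊆V ∘ impR (◃-isRed r na))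
  holds×fails (A ∘' B) na occ⊆V = holds×fails A (◃-normal lam na) (occ⊆V ∘ fusL (◃-isRed lam na))

  holds×failsᴮ : ∀ X {a} → Normal a → (∀ {p x} → OccB a X p x → V p x)
               → Holdsᴮ X a × Failsᴮ X a
  holds×failsᴮ (fm A)   na occ⊆V = holds×fails A na (occ⊆V ∘ leaf)
  holds×failsᴮ (X ,, Y) na occ⊆V =
    Prod.zip _,_ (λ f _ → inj₁ f) (holds×failsᴮ X na (occ⊆V ∘ comL))
                                  (holds×failsᴮ Y na (occ⊆V ∘ comR))
  holds×failsᴮ (X ︔ Y)  na occ⊆V = holds×failsᴮ X (◃-normal lam na) (occ⊆V ∘ semL (◃-isRed lam na))

  Witness : Fm At → Seq → Set
  Witness A a = Σ At λ p → Σ Seq λ x → Normal x × V p x × OccF a A p x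

  witness-map : ∀ {A B a b} → (∀ {p x} → OccF b A p x → OccF a B p x) → Witness A b → Witness B a
  witness-map f (p , x , nx , v , occ) = p , x , nx , v , f occ

  witness : ∀ A {a} → Normal a → Holds A a ⊎ Fails A a → Witness A a
  witness (atom p) {a} na v           = p , a , na , Sum.reduce v , here
  witness (¬' A)   na v                = witness-map (neg (◃-isRed n na))
                                                     (witness A (◃-normal n na) (Sum.swap v))
  witness (A ∧' B) na (inj₁ (h , _))   = witness-map andL (witness A na (inj₁ h))
  witness (A ∧' B) na (inj₂ (inj₁ f))  = witness-map andL (witness A na (inj₂ f))
  witness (A ∧' B) na (inj₂ (inj₂ f))  = witness-map andR (witness B na (inj₂ f))
  witness (A ∨' B) na (inj₁ (inj₁ h))  = witness-map orL (witness A na (inj₁ h))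
  witness (A ∨' B) na (inj₁ (inj₂ h))  = witness-map orR (witness B na (inj₁ h))
  witness (A ∨' B) na (inj₂ (f , _))   = witness-map orL (witness A na (inj₂ f))
  witness (A ⇒' B) na v                = witness-map (impR (◃-isRed r na))
                                                     (witness B (◃-normal r na) v)
  witness (A ∘' B) na v                = witness-map (fusL (◃-isRed lam na))
                                                     (witness A (◃-normal lam na) v)

corollary43 : {At : Set} (X : Bunch At) (A : Fm At) → ⊢B X A
    → Σ At (λ p → Σ Seq (λ x → Reduced x × OccB [] X p x × OccF [] A p x))
corollary43 X A d =
  let open Semantics (λ p x → OccB [] X p x)
      X-holds = proj₁ (holds×failsᴮ X [] (λ occ → occ))
      p , x , nx , inX , inA = witness A [] (inj₁ (proj₁ (pointwise (sound d) []) X-holds))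
  in p , x , Normal⇒Reduced nx , inX , inA
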